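{- Let $\mathbf u\in\{0,1\}^{\mathbb N}$ and $\mathbf v=S(\mathbf u)$. The set of factors of $\mathbf u$ contains infinitely many $E$-palindromes and infinitely many $R$-palindromes if and only if the set of factors of $\mathbf v$ contains infinitely many $R$-palindromes centered at the letter $1$ and infinitely many $R$-palindromes not centered at the letter $1$.
   Context: $R$ is reversal; $E$ the antimorphism $E(w_0\cdots w_n)=\overline{w_n}\cdots\overline{w_0}$ with $\overline0=1,\overline1=0$; a $\Psi$-palindrome is a word $p$ with $\Psi(p)=p$. An $R$-palindrome $w$ is centered at $x\in\{0,1,\varepsilon\}$ if $w=yxR(y)$ for some word $y$ (even-length palindromes are centered at the empty word $\varepsilon$). $S(u_0u_1\cdots)=v_1v_2\cdots$ with $v_i=(u_{i-1}+u_i)\bmod2$. -}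

module Defs where

open import Data.Bool using (Bool; true; false; not; _xor_)
open import Data.Nat using (ℕ; suc; _+_)
open import Data.List using (List; []; _∷_; _++_; [_]; map; reverse; length; upTo)
open import Data.List.Membership.Propositional using (_∉_)
open import Data.Maybe using (Maybe; just; nothing)
open import Data.Product using (Σ; ∃; _×_)
open import Relation.Binary.PropositionalEquality using (_≡_)

-- Letters: false = 0, true = 1.  Finite words are List Bool,
-- infinite words are functions ℕ → Bool.
Word : Set
Word = List Bool

InfWord : Set
InfWord = ℕ → Bool

factorAt : InfWord → ℕ → ℕ → Word
factorAt u i n = map (λ j → u (i + j)) (upTo n)

IsFactor : InfWord → Word → Set
IsFactor u w = ∃ λ i → w ≡ factorAt u i (length w)

S : InfWord → InfWord
S u k = u k xor u (suc k)

R : Word → Word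
R = reverse

E : Word → Word
E w = reverse (map not w)

IsPal : (Word → Word) → Word → Set
IsPal Ψ p = Ψ p ≡ p

-- an R-palindrome w is centered at x ∈ {0,1,ε}  (nothing = ε)
CenteredAt : Maybe Bool → Word → Set
CenteredAt (just x) w = ∃ λ y → w ≡ y ++ [ x ] ++ R y
CenteredAt nothing  w = ∃ λ y → w ≡ y ++ R y

InfinitelyMany : (Word → Set) → Set
InfinitelyMany P = (L : List Word) → ∃ λ w → P w × w ∉ L

-- Differencing a finite word loses only its first letter: a word w with first
-- letter a is recovered from diff w by integration from a.  Reversing an
-- integrated word integrates the reversed differences from the last letter,
-- which is a xor parity p; so integrate a p is an R-palindrome iff p is an
-- R-palindrome of even parity, and an E-palindrome iff p is an R-palindrome of
-- odd parity.  An R-palindrome has odd parity iff it is centered at 1.  Since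
-- factors of u differentiate to factors of S u, and each factor of S u
-- integrates (from the right letter of u) to a factor of u, with at most two
-- preimages per word, infinitude transfers in both directions.
module Submission where

open import Defs
open import Data.Bool using (Bool; true; false; not; _xor_)
open import Data.Bool.Properties
  using (xor-assoc; xor-comm; xor-same; xor-identityʳ; xor-inverseˡ; not-distribˡ-xor)
open import Data.Maybe using (just; nothing; fromMaybe)
open import Data.Product using (_×_; _,_; proj₁; ∃)
open import Relation.Nullary using (¬_)
open import Function using (_∘_)
open import Function.Bundles using (_⇔_; mk⇔; Equivalence)
open import Data.Nat using (zero; suc; _+_)
open import Data.Nat.Properties using (+-suc; +-identityʳ; suc-injective; +-comm)
open import Data.List
  using (List; []; _∷_; _++_; [_]; map; reverse; length; upTo; applyUpTo; _∷ʳ_;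
         initLast; _∷ʳ′_; cartesianProductWith)
open import Data.List.Properties
  using (map-upTo; map-∘; map-cong; length-map; length-upTo; length-++; unfold-reverse;
         reverse-++; ∷-injective; ∷ʳ-injective; ++-assoc)
open import Data.List.Membership.Propositional using (_∈_)
open import Data.List.Membership.Propositional.Properties using (∈-map⁺; ∈-cartesianProductWith⁺)
open import Data.List.Relation.Unary.Any using (here; there)
open import Data.Empty using (⊥-elim)
open import Relation.Binary.PropositionalEquality
  using (_≡_; _≢_; refl; sym; trans; cong; cong₂; subst; module ≡-Reasoning)

xor-cancelˡ : ∀ a b → a xor (a xor b) ≡ b
xor-cancelˡ a b = trans (sym (xor-assoc a a b)) (cong (_xor b) (xor-same a))

xor-cancelʳ : ∀ a b → (a xor b) xor b ≡ a
xor-cancelʳ a b = trans (xor-assoc a b b) (trans (cong (a xor_) (xor-same b)) (xor-identityʳ a))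

xor-solve : ∀ a x b → a xor x ≡ b ⇔ x ≡ a xor b
xor-solve a x b = mk⇔
  (λ eq → trans (sym (xor-cancelˡ a x)) (cong (a xor_) eq))
  (λ eq → trans (cong (a xor_) eq) (xor-cancelˡ a b))

diff : Word → Word
diff []          = []
diff (a ∷ [])    = []
diff (a ∷ b ∷ t) = (a xor b) ∷ diff (b ∷ t)

integrate : Bool → Word → Word
integrate a []      = [ a ]
integrate a (x ∷ p) = a ∷ integrate (a xor x) p

parity : Word → Bool
parity []      = false
parity (x ∷ w) = x xor parity w

diff-integrate : ∀ a p → diff (integrate a p) ≡ p
diff-integrate a []          = refl
diff-integrate a (x ∷ [])    = cong (_∷ []) (xor-cancelˡ a x)
diff-integrate a (x ∷ y ∷ p) = cong₂ _∷_ (xor-cancelˡ a x) (diff-integrate (a xor x) (y ∷ p))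

integrate-diff : ∀ a t → integrate a (diff (a ∷ t)) ≡ a ∷ t
integrate-diff a []      = refl
integrate-diff a (b ∷ t) = cong (a ∷_) (subst (λ c → integrate c (diff (b ∷ t)) ≡ b ∷ t)
                                              (sym (xor-cancelˡ a b)) (integrate-diff b t))

integrate-injective : ∀ {a b} p q → integrate a p ≡ integrate b q → a ≡ b × p ≡ q
integrate-injective {a} {b} p q eq =
  first-letter p (subst (λ r → integrate a p ≡ integrate b r) (sym p≡q) eq) , p≡q
  where
  p≡q : p ≡ q
  p≡q = trans (sym (diff-integrate a p)) (trans (cong diff eq) (diff-integrate b q))
  first-letter : ∀ p → integrate a p ≡ integrate b p → a ≡ b
  first-letter []      refl = refl
  first-letter (_ ∷ _) refl = refl

map-not-integrate : ∀ a p → map not (integrate a p) ≡ integrate (not a) p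
map-not-integrate a []      = refl
map-not-integrate a (x ∷ p) =
  cong (not a ∷_) (trans (map-not-integrate (a xor x) p)
                         (cong (λ c → integrate c p) (not-distribˡ-xor a x)))

parity-++ : ∀ v w → parity (v ++ w) ≡ parity v xor parity w
parity-++ []      w = refl
parity-++ (x ∷ v) w = trans (cong (x xor_) (parity-++ v w)) (sym (xor-assoc x (parity v) (parity w)))

parity-reverse : ∀ w → parity (reverse w) ≡ parity w
parity-reverse []      = refl
parity-reverse (x ∷ w) = begin
  parity (reverse (x ∷ w))         ≡⟨ cong parity (unfold-reverse x w) ⟩
  parity (reverse w ++ [ x ])      ≡⟨ parity-++ (reverse w) [ x ] ⟩
  parity (reverse w) xor (x xor false) ≡⟨ cong₂ _xor_ (parity-reverse w) (xor-identityʳ x) ⟩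
  parity w xor x                   ≡⟨ xor-comm (parity w) x ⟩
  x xor parity w                   ∎
  where open ≡-Reasoning

integrate-∷ʳ : ∀ a p x → integrate a (p ∷ʳ x) ≡ integrate a p ∷ʳ ((a xor parity p) xor x)
integrate-∷ʳ a []      x = cong (λ c → a ∷ [ c xor x ]) (sym (xor-identityʳ a))
integrate-∷ʳ a (y ∷ p) x =
  cong (a ∷_) (trans (integrate-∷ʳ (a xor y) p x)
                     (cong (λ c → integrate (a xor y) p ∷ʳ (c xor x)) (xor-assoc a y (parity p))))

reverse-integrate : ∀ a p → reverse (integrate a p) ≡ integrate (a xor parity p) (reverse p)
reverse-integrate a []      = cong [_] (sym (xor-identityʳ a))
reverse-integrate a (x ∷ p) = begin
  reverse (a ∷ integrate (a xor x) p)              ≡⟨ unfold-reverse a (integrate (a xor x) p) ⟩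
  reverse (integrate (a xor x) p) ∷ʳ a             ≡⟨ cong (_∷ʳ a) (reverse-integrate (a xor x) p) ⟩
  integrate c (reverse p) ∷ʳ a                     ≡⟨ cong (integrate c (reverse p) ∷ʳ_) last ⟩
  integrate c (reverse p) ∷ʳ ((c xor parity (reverse p)) xor x) ≡⟨ integrate-∷ʳ c (reverse p) x ⟨
  integrate c (reverse p ∷ʳ x)                     ≡⟨ cong₂ integrate (xor-assoc a x (parity p))
                                                                      (sym (unfold-reverse x p)) ⟩
  integrate (a xor parity (x ∷ p)) (reverse (x ∷ p)) ∎
  where
  open ≡-Reasoning
  c = (a xor x) xor parity p
  last : a ≡ (c xor parity (reverse p)) xor x
  last = sym (begin
    (c xor parity (reverse p)) xor x ≡⟨ cong (λ r → (c xor r) xor x) (parity-reverse p) ⟩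
    (c xor parity p) xor x           ≡⟨ cong (_xor x) (xor-cancelʳ (a xor x) (parity p)) ⟩
    (a xor x) xor x                  ≡⟨ xor-cancelʳ a x ⟩
    a                                ∎)

E-integrate : ∀ a p → E (integrate a p) ≡ integrate (not a xor parity p) (R p)
E-integrate a p = trans (cong reverse (map-not-integrate a p)) (reverse-integrate (not a) p)

IsPal-E-integrate : ∀ a p → IsPal E (integrate a p) ⇔ (IsPal R p × parity p ≡ true)
IsPal-E-integrate a p = mk⇔
  (λ pal → let first , rp = integrate-injective (R p) p (trans (sym (E-integrate a p)) pal) in
           rp , trans (Equivalence.to (xor-solve (not a) (parity p) a) first) (xor-inverseˡ a))
  (λ (rp , odd) → trans (E-integrate a p)
     (cong₂ integrate (Equivalence.from (xor-solve (not a) (parity p) a) (trans odd (sym (xor-inverseˡ a)))) rp))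

IsPal-R-integrate : ∀ a p → IsPal R (integrate a p) ⇔ (IsPal R p × parity p ≡ false)
IsPal-R-integrate a p = mk⇔
  (λ pal → let first , rp = integrate-injective (R p) p (trans (sym (reverse-integrate a p)) pal) in
           rp , trans (Equivalence.to (xor-solve a (parity p) a) first) (xor-same a))
  (λ (rp , even) → trans (reverse-integrate a p)
     (cong₂ integrate (Equivalence.from (xor-solve a (parity p) a) (trans even (sym (xor-same a)))) rp))

length-∷-∷ʳ : ∀ (a : Bool) q b → length (a ∷ (q ∷ʳ b)) ≡ suc (suc (length q))
length-∷-∷ʳ a q b = cong suc (trans (length-++ q) (+-comm (length q) 1))

reverse-∷-∷ʳ : ∀ (a : Bool) q b → reverse (a ∷ (q ∷ʳ b)) ≡ b ∷ (reverse q ∷ʳ a)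
reverse-∷-∷ʳ a q b = trans (unfold-reverse a (q ∷ʳ b)) (cong (_∷ʳ a) (reverse-++ q [ b ]))

wrap-centred : ∀ (a : Bool) y m → a ∷ ((y ++ m ++ R y) ∷ʳ a) ≡ (a ∷ y) ++ m ++ R (a ∷ y)
wrap-centred a y m = cong (a ∷_) (begin
  (y ++ m ++ R y) ++ [ a ] ≡⟨ ++-assoc y (m ++ R y) [ a ] ⟩
  y ++ (m ++ R y) ++ [ a ] ≡⟨ cong (y ++_) (++-assoc m (R y) [ a ]) ⟩
  y ++ m ++ (R y ∷ʳ a)     ≡⟨ cong (λ z → y ++ m ++ z) (unfold-reverse a y) ⟨
  y ++ m ++ R (a ∷ y)      ∎)
  where open ≡-Reasoning

CenteredAt-wrap : ∀ c a q → CenteredAt c q → CenteredAt c (a ∷ (q ∷ʳ a))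
CenteredAt-wrap (just x) a q (y , refl) = a ∷ y , wrap-centred a y [ x ]
CenteredAt-wrap nothing  a q (y , refl) = a ∷ y , wrap-centred a y []

-- Peeling both end letters off via initLast is not structural; the length index n is.
palindrome-centre′ : ∀ n p → length p ≡ n → IsPal R p → ∃ λ c → CenteredAt c p
palindrome-centre-∷ʳ : ∀ n a q b → length (a ∷ (q ∷ʳ b)) ≡ n → IsPal R (a ∷ (q ∷ʳ b)) →
                       ∃ λ c → CenteredAt c (a ∷ (q ∷ʳ b))

palindrome-centre′ n []      _   _   = nothing , [] , refl
palindrome-centre′ n (a ∷ p) len pal with initLast p
... | []       = just a , [] , refl
... | q ∷ʳ′ b = palindrome-centre-∷ʳ n a q b len pal

palindrome-centre-∷ʳ (suc (suc n)) a q b len pal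
  with ∷-injective (trans (sym (reverse-∷-∷ʳ a q b)) pal)
... | refl , rest =
  let lenq = suc-injective (suc-injective (trans (sym (length-∷-∷ʳ a q b)) len))
      c , centred = palindrome-centre′ n q lenq (proj₁ (∷ʳ-injective (R q) q rest))
  in c , CenteredAt-wrap c a q centred
palindrome-centre-∷ʳ zero          a q b len _ with () ← trans (sym (length-∷-∷ʳ a q b)) len
palindrome-centre-∷ʳ (suc zero)    a q b len _ with () ← trans (sym (length-∷-∷ʳ a q b)) len

palindrome-centre : ∀ p → IsPal R p → ∃ λ c → CenteredAt c p
palindrome-centre p = palindrome-centre′ (length p) p refl

parity-centred : ∀ y m → parity (y ++ m ++ R y) ≡ parity m
parity-centred y m = begin
  parity (y ++ m ++ R y)                    ≡⟨ parity-++ y (m ++ R y) ⟩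
  parity y xor parity (m ++ R y)            ≡⟨ cong (parity y xor_) (parity-++ m (R y)) ⟩
  parity y xor (parity m xor parity (R y))  ≡⟨ cong (λ r → parity y xor (parity m xor r)) (parity-reverse y) ⟩
  parity y xor (parity m xor parity y)      ≡⟨ cong (parity y xor_) (xor-comm (parity m) (parity y)) ⟩
  parity y xor (parity y xor parity m)      ≡⟨ xor-cancelˡ (parity y) (parity m) ⟩
  parity m                                  ∎
  where open ≡-Reasoning

parity-CenteredAt : ∀ c p → CenteredAt c p → parity p ≡ fromMaybe false c
parity-CenteredAt (just x) _ (y , refl) = trans (parity-centred y [ x ]) (xor-identityʳ x)
parity-CenteredAt nothing  _ (y , refl) = parity-centred y []

CenteredAt-1⇔odd : ∀ p → IsPal R p → CenteredAt (just true) p ⇔ parity p ≡ true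
CenteredAt-1⇔odd p pal = mk⇔ (parity-CenteredAt (just true) p) from
  where
  from : parity p ≡ true → CenteredAt (just true) p
  from odd with palindrome-centre p pal
  ... | nothing , centred with () ← trans (sym (parity-CenteredAt nothing p centred)) odd
  ... | just x  , centred with refl ← trans (sym (parity-CenteredAt (just x) p centred)) odd = centred

¬CenteredAt-1⇔even : ∀ p → IsPal R p → (¬ CenteredAt (just true) p) ⇔ parity p ≡ false
¬CenteredAt-1⇔even p pal = mk⇔ to from
  where
  to : ¬ CenteredAt (just true) p → parity p ≡ false
  to ¬centred with parity p in eq
  ... | false = refl
  ... | true  = ⊥-elim (¬centred (Equivalence.from (CenteredAt-1⇔odd p pal) eq))
  from : parity p ≡ false → ¬ CenteredAt (just true) p
  from even centred with () ← trans (sym even) (parity-CenteredAt (just true) p centred)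

IsPal-E-integrate⇔centred-1 : ∀ a p → IsPal E (integrate a p) ⇔ (IsPal R p × CenteredAt (just true) p)
IsPal-E-integrate⇔centred-1 a p = mk⇔
  (λ pal → let rp , odd = Equivalence.to (IsPal-E-integrate a p) pal
           in rp , Equivalence.from (CenteredAt-1⇔odd p rp) odd)
  (λ (rp , centred) → Equivalence.from (IsPal-E-integrate a p)
                        (rp , Equivalence.to (CenteredAt-1⇔odd p rp) centred))

IsPal-R-integrate⇔uncentred-1 : ∀ a p → IsPal R (integrate a p) ⇔ (IsPal R p × ¬ CenteredAt (just true) p)
IsPal-R-integrate⇔uncentred-1 a p = mk⇔
  (λ pal → let rp , even = Equivalence.to (IsPal-R-integrate a p) pal
           in rp , Equivalence.from (¬CenteredAt-1⇔even p rp) even)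
  (λ (rp , ¬centred) → Equivalence.from (IsPal-R-integrate a p)
                         (rp , Equivalence.to (¬CenteredAt-1⇔even p rp) ¬centred))

factorAt-suc : ∀ u i n → factorAt u i (suc n) ≡ u i ∷ factorAt u (suc i) n
factorAt-suc u i n = cong₂ _∷_ (cong u (+-identityʳ i)) (begin
  map g (applyUpTo suc n)           ≡⟨ cong (map g) (map-upTo suc n) ⟨
  map g (map suc (upTo n))          ≡⟨ map-∘ (upTo n) ⟨
  map (g ∘ suc) (upTo n)            ≡⟨ map-cong (λ j → cong u (+-suc i j)) (upTo n) ⟩
  map (λ j → u (suc i + j)) (upTo n) ∎)
  where
  open ≡-Reasoning
  g = λ j → u (i + j)

length-factorAt : ∀ u i n → length (factorAt u i n) ≡ n
length-factorAt u i n = trans (length-map _ (upTo n)) (length-upTo n)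

diff-factorAt : ∀ u i n → diff (factorAt u i (suc n)) ≡ factorAt (S u) i n
diff-factorAt u i zero    = refl
diff-factorAt u i (suc n) = begin
  diff (factorAt u i (suc (suc n)))             ≡⟨ cong diff (factorAt-suc u i (suc n)) ⟩
  diff (u i ∷ factorAt u (suc i) (suc n))       ≡⟨ cong (λ w → diff (u i ∷ w)) (factorAt-suc u (suc i) n) ⟩
  S u i ∷ diff (u (suc i) ∷ factorAt u (suc (suc i)) n) ≡⟨ cong (λ w → S u i ∷ diff w) (factorAt-suc u (suc i) n) ⟨
  S u i ∷ diff (factorAt u (suc i) (suc n))     ≡⟨ cong (S u i ∷_) (diff-factorAt u (suc i) n) ⟩
  S u i ∷ factorAt (S u) (suc i) n              ≡⟨ factorAt-suc (S u) i n ⟨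
  factorAt (S u) i (suc n)                      ∎
  where open ≡-Reasoning

factorAt⇒IsFactor : ∀ u i n {w} → w ≡ factorAt u i n → IsFactor u w
factorAt⇒IsFactor u i n eq =
  i , trans eq (cong (factorAt u i) (sym (trans (cong length eq) (length-factorAt u i n))))

IsFactor-diff : ∀ u {w} → IsFactor u w → IsFactor (S u) (diff w)
IsFactor-diff u {[]}    _        = factorAt⇒IsFactor (S u) 0 0 refl
IsFactor-diff u {a ∷ t} (i , eq) =
  factorAt⇒IsFactor (S u) i (length t) (trans (cong diff eq) (diff-factorAt u i (length t)))

IsFactor-integrate : ∀ u {p} → IsFactor (S u) p → ∃ λ a → IsFactor u (integrate a p)
IsFactor-integrate u {p} (i , eq) = u i , factorAt⇒IsFactor u i (suc (length p)) (begin
  integrate (u i) p                                           ≡⟨ cong (integrate (u i)) (trans eq (sym (diff-factorAt u i (length p)))) ⟩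
  integrate (u i) (diff (factorAt u i (suc (length p))))      ≡⟨ cong (integrate (u i) ∘ diff) (factorAt-suc u i (length p)) ⟩
  integrate (u i) (diff (u i ∷ factorAt u (suc i) (length p))) ≡⟨ integrate-diff (u i) _ ⟩
  u i ∷ factorAt u (suc i) (length p)                         ≡⟨ factorAt-suc u i (length p) ⟨
  factorAt u i (suc (length p))                               ∎)
  where open ≡-Reasoning

InfinitelyMany-transfer : ∀ {P Q : Word → Set} (cover : List Word → List Word) →
  (∀ {w} → P w → ∃ λ v → Q v × (∀ {L} → v ∈ L → w ∈ cover L)) →
  InfinitelyMany P → InfinitelyMany Q
InfinitelyMany-transfer cover step inf L with inf (cover L)
... | w , pw , w∉cover = let v , qv , back = step pw in v , qv , w∉cover ∘ back

InfinitelyMany-≢[] : ∀ {P : Word → Set} → InfinitelyMany P → InfinitelyMany (λ w → P w × w ≢ [])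
InfinitelyMany-≢[] inf L with inf ([] ∷ L)
... | w , pw , w∉ = w , (pw , λ { refl → w∉ (here refl) }) , w∉ ∘ there

integrals : List Word → List Word
integrals = cartesianProductWith integrate (false ∷ true ∷ [])

∈-integrals : ∀ a {p L} → p ∈ L → integrate a p ∈ integrals L
∈-integrals false = ∈-cartesianProductWith⁺ integrate {xs = false ∷ true ∷ []} (here refl)
∈-integrals true  = ∈-cartesianProductWith⁺ integrate {xs = false ∷ true ∷ []} (there (here refl))

infinitelyMany-diff : ∀ u {Q T : Word → Set} → (∀ {a p} → Q (integrate a p) → T p) →
  InfinitelyMany (λ w → IsFactor u w × Q w) → InfinitelyMany (λ p → IsFactor (S u) p × T p)
infinitelyMany-diff u {Q} {T} QT = InfinitelyMany-transfer integrals step ∘ InfinitelyMany-≢[]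
  where
  step : ∀ {w} → (IsFactor u w × Q w) × w ≢ [] →
         ∃ λ p → (IsFactor (S u) p × T p) × (∀ {L} → p ∈ L → w ∈ integrals L)
  step {[]}    (_ , nonempty)     = ⊥-elim (nonempty refl)
  step {a ∷ t} ((factor , q) , _) =
    diff (a ∷ t) ,
    (IsFactor-diff u factor , QT (subst Q (sym (integrate-diff a t)) q)) ,
    λ p∈L → subst (_∈ _) (integrate-diff a t) (∈-integrals a p∈L)

infinitelyMany-integrate : ∀ u {Q T : Word → Set} → (∀ {a p} → T p → Q (integrate a p)) →
  InfinitelyMany (λ p → IsFactor (S u) p × T p) → InfinitelyMany (λ w → IsFactor u w × Q w)
infinitelyMany-integrate u {Q} {T} TQ = InfinitelyMany-transfer (map diff) step
  where
  step : ∀ {p} → IsFactor (S u) p × T p →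
         ∃ λ w → (IsFactor u w × Q w) × (∀ {L} → w ∈ L → p ∈ map diff L)
  step {p} (factor , t) =
    let a , factor′ = IsFactor-integrate u factor
    in integrate a p , (factor′ , TQ t) , λ w∈L → subst (_∈ _) (diff-integrate a p) (∈-map⁺ diff w∈L)

mainTheorem14 : (u : InfWord) →
    (InfinitelyMany (λ w → IsFactor u w × IsPal E w) × InfinitelyMany (λ w → IsFactor u w × IsPal R w))
    ⇔ (InfinitelyMany (λ w → IsFactor (S u) w × IsPal R w × CenteredAt (just true) w)
    × InfinitelyMany (λ w → IsFactor (S u) w × IsPal R w × ¬ CenteredAt (just true) w))
mainTheorem14 u = mk⇔
  (λ (Epals , Rpals) →
      infinitelyMany-diff u (Equivalence.to (IsPal-E-integrate⇔centred-1 _ _)) Epals ,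
      infinitelyMany-diff u (Equivalence.to (IsPal-R-integrate⇔uncentred-1 _ _)) Rpals)
  (λ (centred , uncentred) →
      infinitelyMany-integrate u (Equivalence.from (IsPal-E-integrate⇔centred-1 _ _)) centred ,
      infinitelyMany-integrate u (Equivalence.from (IsPal-R-integrate⇔uncentred-1 _ _)) uncentred)
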